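{- Let $3\le m\le n$ and let $c$ be an exact $(m+n+1)$-coloring of $[m]\times[n]$ with no rainbow solution to $x_1+x_2=x_3$. Then at most $|c(D_m)|-3$ off-diagonals do not contribute a color.
   Context: $[m]\times[n]=\{(i,j)\in\mathbb{Z}^2:1\le i\le m,1\le j\le n\}$ with componentwise addition. An $r$-coloring is a map $c:[m]\times[n]\to\{1,\dots,r\}$, exact if surjective; a rainbow solution is a triple $\alpha,\beta,\gamma$ with $\alpha+\beta=\gamma$ and pairwise distinct colors. For $1\le k\le m+n-1$, $D_k=\{(i,j)\in[m]\times[n]:m-k=i-j\}$; $D_m$ is the main diagonal and the $D_k$ with $k\ne m$ are the off-diagonals; $c(X)=\{c(x):x\in X\}$. Diagonal $D_j$ contributes color $x$ if $x\in c(D_j)\setminus c(D_m)$ and $x\notin c(D_i)$ for all $i<j$; $D_j$ contributes a color (is contributing) if it contributes some color. -}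

module Defs where

open import Data.Nat using (ℕ; _+_; _∸_; _≤_; _<_; _≟_; _≡ᵇ_)
open import Data.Nat.Properties using ()
open import Data.Bool using (if_then_else_)
open import Data.List using (List; []; _∷_; _++_; concatMap; length; deduplicate; upTo; map)
open import Data.List.Membership.Propositional using (_∈_; _∉_)
open import Data.Product using (_×_; ∃; ∃-syntax; Σ-syntax)
open import Relation.Binary.PropositionalEquality using (_≡_; _≢_)
open import Relation.Nullary using (¬_)

-- A coloring of [m]×[n] is given as a function ℕ → ℕ → ℕ; only its values
-- on the grid (1 ≤ i ≤ m, 1 ≤ j ≤ n, 1-based coordinates) matter.
Coloring : Set
Coloring = ℕ → ℕ → ℕ

InGrid : ℕ → ℕ → ℕ → ℕ → Set
InGrid m n i j = (1 ≤ i × i ≤ m) × (1 ≤ j × j ≤ n)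

ExactColoring : ℕ → ℕ → ℕ → Coloring → Set
ExactColoring m n r c =
  (∀ i j → InGrid m n i j → 1 ≤ c i j × c i j ≤ r) ×
  (∀ x → 1 ≤ x → x ≤ r → ∃[ i ] ∃[ j ] (InGrid m n i j × c i j ≡ x))

RainbowSolution : ℕ → ℕ → Coloring → Set
RainbowSolution m n c =
  ∃[ a₁ ] ∃[ a₂ ] ∃[ b₁ ] ∃[ b₂ ] ∃[ g₁ ] ∃[ g₂ ]
    (InGrid m n a₁ a₂ × InGrid m n b₁ b₂ × InGrid m n g₁ g₂ ×
     a₁ + b₁ ≡ g₁ × a₂ + b₂ ≡ g₂ ×
     c a₁ a₂ ≢ c b₁ b₂ × c a₁ a₂ ≢ c g₁ g₂ × c b₁ b₂ ≢ c g₁ g₂)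

range1 : ℕ → List ℕ
range1 k = map (1 +_) (upTo k)

-- (i,j) ∈ D_k  iff  m - k = i - j  (over ℤ)  iff  i + k = m + j
-- c(D_k) as a list of colors (with repetitions)
colorsOn : ℕ → ℕ → Coloring → ℕ → List ℕ
colorsOn m n c k =
  concatMap (λ i → concatMap (λ j →
    if (i + k) ≡ᵇ (m + j) then c i j ∷ [] else []) (range1 n)) (range1 m)

numColorsOn : ℕ → ℕ → Coloring → ℕ → ℕ
numColorsOn m n c k = length (deduplicate _≟_ (colorsOn m n c k))

ContributesColor : ℕ → ℕ → Coloring → ℕ → ℕ → Set
ContributesColor m n c k x =
  x ∈ colorsOn m n c k × x ∉ colorsOn m n c m ×
  (∀ i → 1 ≤ i → i < k → x ∉ colorsOn m n c i)

Contributes : ℕ → ℕ → Coloring → ℕ → Set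
Contributes m n c k = ∃[ x ] ContributesColor m n c k x

NonContributingOffDiagonal : ℕ → ℕ → Coloring → ℕ → Set
NonContributingOffDiagonal m n c k =
  (1 ≤ k × k ≤ m + n ∸ 1) × k ≢ m × ¬ Contributes m n c k

-- Every colour either appears on the main diagonal D_m or is contributed by exactly one
-- off-diagonal, namely the first diagonal on which it appears. An off-diagonal D_k cannot
-- contribute two colours: if points α and α + (d,d) of D_k carry distinct colours outside
-- c(D_m), then (d,d) ∈ D_m and α + (d,d) is a rainbow solution.
-- Charging colours to D_m or to their contributing diagonal therefore gives
--   m + n + 1 ≤ |c(D_m)| + (m + n − 2 − #non-contributing off-diagonals).
module Submission where

open import Defs
open import Data.Bool using (true; T; if_then_else_)
open import Data.Empty using (⊥; ⊥-elim)
open import Data.List using (List; []; _∷_; _++_; length; map; upTo; deduplicate)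
open import Data.List.Membership.Propositional using (_∈_; _∉_; find; lose)
open import Data.List.Membership.Propositional.Properties
  using (∈-map⁺; ∈-map⁻; ∈-upTo⁺; ∈-upTo⁻; ∈-++⁺ˡ; ∈-++⁺ʳ; ∈-++⁻; ∈-∃++;
         ∈-concatMap⁺; ∈-concatMap⁻; ∈-deduplicate⁺)
open import Data.List.Properties using (length-++; length-++-sucʳ; length-map; length-upTo)
open import Data.List.Relation.Unary.All as All using (All)
open import Data.List.Relation.Unary.AllPairs using (_∷_)
open import Data.List.Relation.Unary.Any using (here; there)
open import Data.List.Relation.Unary.Unique.Propositional using (Unique)
import Data.List.Relation.Unary.Unique.Propositional.Properties as Unique
open import Data.Nat using (ℕ; zero; suc; _+_; _∸_; _≤_; _<_; _≟_; _≡ᵇ_; z≤n; s≤s)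
open import Data.Nat.Properties
open import Data.List.Membership.DecPropositional _≟_ using (_∈?_)
open import Data.Nat.Solver using (module +-*-Solver)
open import Data.Product using (_×_; _,_; ∃-syntax)
open import Data.Sum using (_⊎_; inj₁; inj₂; [_,_]′)
open import Data.Sum.Properties using (inj₁-injective; inj₂-injective)
open import Function using (_∘_)
open import Relation.Binary using (tri<; tri≈; tri>)
open import Relation.Binary.PropositionalEquality
open import Relation.Nullary using (¬_; yes; no)
open import Relation.Unary using (Decidable)

∈-range1⁻ : ∀ {k x} → x ∈ range1 k → 1 ≤ x × x ≤ k
∈-range1⁻ x∈ with _ , u∈ , refl ← ∈-map⁻ (1 +_) x∈ = s≤s z≤n , ∈-upTo⁻ u∈

∈-range1⁺ : ∀ {k x} → 1 ≤ x → x ≤ k → x ∈ range1 k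
∈-range1⁺ {x = suc x} _ x<k = ∈-map⁺ (1 +_) (∈-upTo⁺ x<k)

range1-unique : ∀ k → Unique (range1 k)
range1-unique k = Unique.map⁺ suc-injective (Unique.upTo⁺ k)

length-range1 : ∀ k → length (range1 k) ≡ k
length-range1 k = trans (length-map (1 +_) (upTo k)) (length-upTo k)

∈-if-singleton⁻ : ∀ {A : Set} b {v x : A} → x ∈ (if b then v ∷ [] else []) → T b × x ≡ v
∈-if-singleton⁻ true (here x≡v) = _ , x≡v

∈-if-singleton⁺ : ∀ {A : Set} b {v : A} → T b → v ∈ (if b then v ∷ [] else [])
∈-if-singleton⁺ true _ = here refl

infixr 5 _⊕_

_⊕_ : {A B : Set} → List A → List B → List (A ⊎ B)
xs ⊕ ys = map inj₁ xs ++ map inj₂ ys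

module _ {A B : Set} {xs : List A} {ys : List B} where

  ∈-⊕-inj₁⁺ : ∀ {x} → x ∈ xs → inj₁ x ∈ xs ⊕ ys
  ∈-⊕-inj₁⁺ x∈ = ∈-++⁺ˡ (∈-map⁺ inj₁ x∈)

  ∈-⊕-inj₂⁺ : ∀ {y} → y ∈ ys → inj₂ y ∈ xs ⊕ ys
  ∈-⊕-inj₂⁺ y∈ = ∈-++⁺ʳ (map inj₁ xs) (∈-map⁺ inj₂ y∈)

  ∈-⊕-inj₁⁻ : ∀ {x} → inj₁ x ∈ xs ⊕ ys → x ∈ xs
  ∈-⊕-inj₁⁻ p with ∈-++⁻ (map inj₁ xs) p
  ... | inj₁ q with _ , x∈ , refl ← ∈-map⁻ inj₁ q = x∈
  ... | inj₂ q with ∈-map⁻ inj₂ q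
  ...   | _ , _ , ()

  ∈-⊕-inj₂⁻ : ∀ {y} → inj₂ y ∈ xs ⊕ ys → y ∈ ys
  ∈-⊕-inj₂⁻ p with ∈-++⁻ (map inj₁ xs) p
  ... | inj₂ q with _ , y∈ , refl ← ∈-map⁻ inj₂ q = y∈
  ... | inj₁ q with ∈-map⁻ inj₁ q
  ...   | _ , _ , ()

  ⊕-unique : Unique xs → Unique ys → Unique (xs ⊕ ys)
  ⊕-unique uxs uys =
    Unique.++⁺ (Unique.map⁺ inj₁-injective uxs) (Unique.map⁺ inj₂-injective uys) disjoint
    where
    disjoint : ∀ {z} → ¬ (z ∈ map inj₁ xs × z ∈ map inj₂ ys)
    disjoint (p , q) with ∈-map⁻ inj₁ p | ∈-map⁻ inj₂ q
    ... | _ , _ , refl | _ , _ , ()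

length-⊕ : {A B : Set} (xs : List A) (ys : List B) → length (xs ⊕ ys) ≡ length xs + length ys
length-⊕ xs ys = trans (length-++ (map inj₁ xs)) (cong₂ _+_ (length-map inj₁ xs) (length-map inj₂ ys))

length-⊕-range1ˡ : {B : Set} (k : ℕ) (ys : List B) → length (range1 k ⊕ ys) ≡ k + length ys
length-⊕-range1ˡ k ys = trans (length-⊕ (range1 k) ys) (cong (_+ length ys) (length-range1 k))

length-⊕-range1ʳ : {A : Set} (xs : List A) (k : ℕ) → length (xs ⊕ range1 k) ≡ length xs + k
length-⊕-range1ʳ xs k = trans (length-⊕ xs (range1 k)) (cong (length xs +_) (length-range1 k))

length-≤-of-injective-relation : {A B : Set} (R : A → B → Set) {xs : List A} {ys : List B} →
  Unique xs →
  (∀ {a} → a ∈ xs → ∃[ b ] (b ∈ ys × R a b)) →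
  (∀ {a a′ b} → a ∈ xs → a′ ∈ xs → R a b → R a′ b → a ≡ a′) →
  length xs ≤ length ys
length-≤-of-injective-relation R {[]} _ _ _ = z≤n
length-≤-of-injective-relation R {a ∷ xs} (a∉xs ∷ uxs) image injective
  with b , b∈ys , Rab ← image (here refl)
  with us , vs , refl ← ∈-∃++ b∈ys =
  subst (suc (length xs) ≤_) (sym (length-++-sucʳ us b vs))
    (s≤s (length-≤-of-injective-relation R uxs image′ (λ p q → injective (there p) (there q))))
  where
  image′ : ∀ {a′} → a′ ∈ xs → ∃[ b′ ] (b′ ∈ us ++ vs × R a′ b′)
  image′ p with b′ , b′∈ , Ra′b′ ← image (there p) with ∈-++⁻ us b′∈
  ... | inj₁ q         = b′ , ∈-++⁺ˡ q , Ra′b′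
  ... | inj₂ (there q) = b′ , ∈-++⁺ʳ us q , Ra′b′
  ... | inj₂ (here refl) = ⊥-elim (All.lookup a∉xs p (injective (here refl) (there p) Rab Ra′b′))

module _ {P : ℕ → Set} (P? : Decidable P) where

  least-below-or-none : ∀ b →
    (∃[ l ] (l < b × P l × (∀ i → i < l → ¬ P i))) ⊎ (∀ i → i < b → ¬ P i)
  least-below-or-none zero = inj₂ λ _ ()
  least-below-or-none (suc b) with least-below-or-none b
  ... | inj₁ (l , l<b , Pl , below) = inj₁ (l , m<n⇒m<1+n l<b , Pl , below)
  ... | inj₂ none with P? b
  ...   | yes Pb = inj₁ (b , n<1+n b , Pb , none)
  ...   | no ¬Pb = inj₂ λ i i<1+b → [ none i , (λ { refl → ¬Pb }) ]′ (m<1+n⇒m<n∨m≡n i<1+b)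

  least-witness : ∀ {k} → P k → ∃[ l ] (l ≤ k × P l × (∀ i → i < l → ¬ P i))
  least-witness {k} Pk with least-below-or-none (suc k)
  ... | inj₁ (l , l<1+k , Pl , below) = l , m<1+n⇒m≤n l<1+k , Pl , below
  ... | inj₂ none = ⊥-elim (none k (n<1+n k) Pk)

same-diagonal-shift : ∀ {m k i j i′ j′ d} →
  i + k ≡ m + j → i′ + k ≡ m + j′ → i + d ≡ i′ → j + d ≡ j′
same-diagonal-shift {m} {k} {i} {j} {i′} {j′} {d} onD onD′ i+d≡i′ = +-cancelˡ-≡ m _ _ (begin
  m + (j + d) ≡⟨ sym (+-assoc m j d) ⟩
  m + j + d   ≡⟨ cong (_+ d) (sym onD) ⟩
  i + k + d   ≡⟨ +-assoc i k d ⟩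
  i + (k + d) ≡⟨ cong (i +_) (+-comm k d) ⟩
  i + (d + k) ≡⟨ sym (+-assoc i d k) ⟩
  i + d + k   ≡⟨ cong (_+ k) i+d≡i′ ⟩
  i′ + k      ≡⟨ onD′ ⟩
  m + j′      ∎)
  where open ≡-Reasoning

module _ (m n : ℕ) (c : Coloring) where

  ∈-colorsOn⁻ : ∀ k {x} → x ∈ colorsOn m n c k →
    ∃[ i ] ∃[ j ] (InGrid m n i j × i + k ≡ m + j × c i j ≡ x)
  ∈-colorsOn⁻ k x∈
    with i , i∈ , x∈row ← find (∈-concatMap⁻ _ {xs = range1 m} x∈)
    with j , j∈ , x∈cell ← find (∈-concatMap⁻ _ {xs = range1 n} x∈row)
    with onD , refl ← ∈-if-singleton⁻ ((i + k) ≡ᵇ (m + j)) x∈cell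
    = i , j , (∈-range1⁻ i∈ , ∈-range1⁻ j∈) , ≡ᵇ⇒≡ (i + k) (m + j) onD , refl

  ∈-colorsOn⁺ : ∀ k {i j} → InGrid m n i j → i + k ≡ m + j → c i j ∈ colorsOn m n c k
  ∈-colorsOn⁺ k {i} {j} ((1≤i , i≤m) , (1≤j , j≤n)) onD =
    ∈-concatMap⁺ _ (lose (∈-range1⁺ 1≤i i≤m) (∈-concatMap⁺ _ (lose (∈-range1⁺ 1≤j j≤n)
      (∈-if-singleton⁺ ((i + k) ≡ᵇ (m + j)) (≡⇒≡ᵇ (i + k) (m + j) onD)))))

  colorsOn-zero-empty : ∀ {x} → x ∉ colorsOn m n c 0
  colorsOn-zero-empty x∈ with i , j , ((_ , i≤m) , (1≤j , _)) , onD , _ ← ∈-colorsOn⁻ 0 x∈ =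
    <⇒≱ (<-≤-trans (m<m+n m 1≤j) (≤-reflexive (trans (sym onD) (+-identityʳ i)))) i≤m

  diagonal-pair-rainbow : ∀ k {i j i′ j′} → i < i′ →
    InGrid m n i j → i + k ≡ m + j → InGrid m n i′ j′ → i′ + k ≡ m + j′ →
    c i j ≢ c i′ j′ → c i j ∉ colorsOn m n c m → c i′ j′ ∉ colorsOn m n c m →
    RainbowSolution m n c
  diagonal-pair-rainbow k {i} {j} {i′} {j′} i<i′ g onD g′@((_ , i′≤m) , (_ , j′≤n)) onD′ α≢γ α∉ γ∉ =
    i , j , d , d , i′ , j′ , g , gβ , g′ , i+d≡i′ , j+d≡j′ , α≢β , α≢γ , β≢γ
    where
    d = i′ ∸ i
    i+d≡i′ : i + d ≡ i′
    i+d≡i′ = m+[n∸m]≡n (<⇒≤ i<i′)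
    j+d≡j′ : j + d ≡ j′
    j+d≡j′ = same-diagonal-shift onD onD′ i+d≡i′
    gβ : InGrid m n d d
    gβ = (m<n⇒0<n∸m i<i′ , ≤-trans (m≤n+m d i) (subst (_≤ m) (sym i+d≡i′) i′≤m))
       , (m<n⇒0<n∸m i<i′ , ≤-trans (m≤n+m d j) (subst (_≤ n) (sym j+d≡j′) j′≤n))
    β∈ : c d d ∈ colorsOn m n c m
    β∈ = ∈-colorsOn⁺ m gβ (+-comm d m)
    α≢β : c i j ≢ c d d
    α≢β eq = α∉ (subst (_∈ colorsOn m n c m) (sym eq) β∈)
    β≢γ : c d d ≢ c i′ j′
    β≢γ eq = γ∉ (subst (_∈ colorsOn m n c m) eq β∈)

  distinct-new-colors-rainbow : ∀ k {x y} → x ∈ colorsOn m n c k → y ∈ colorsOn m n c k →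
    x ∉ colorsOn m n c m → y ∉ colorsOn m n c m → x ≢ y → RainbowSolution m n c
  distinct-new-colors-rainbow k x∈ y∈ x∉ y∉ x≢y
    with i , j , g , onD , refl ← ∈-colorsOn⁻ k x∈
    with i′ , j′ , g′ , onD′ , refl ← ∈-colorsOn⁻ k y∈
    with <-cmp i i′
  ... | tri< i<i′ _ _ = diagonal-pair-rainbow k i<i′ g onD g′ onD′ x≢y x∉ y∉
  ... | tri> _ _ i′<i = diagonal-pair-rainbow k i′<i g′ onD′ g onD (x≢y ∘ sym) y∉ x∉
  ... | tri≈ _ refl _ = ⊥-elim (x≢y (cong (c i) (+-cancelˡ-≡ m _ _ (trans (sym onD) onD′))))

  new-colors-on-diagonal-equal : ¬ RainbowSolution m n c → ∀ k {x y} →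
    x ∈ colorsOn m n c k → y ∈ colorsOn m n c k →
    x ∉ colorsOn m n c m → y ∉ colorsOn m n c m → x ≡ y
  new-colors-on-diagonal-equal no-rainbow k {x} {y} x∈ y∈ x∉ y∉ with x ≟ y
  ... | yes x≡y = x≡y
  ... | no x≢y = ⊥-elim (no-rainbow (distinct-new-colors-rainbow k x∈ y∈ x∉ y∉ x≢y))

  ∈-colorsOn-own-diagonal : ∀ {i j} → InGrid m n i j → c i j ∈ colorsOn m n c (m + j ∸ i)
  ∈-colorsOn-own-diagonal {i} {j} g@((_ , i≤m) , _) =
    ∈-colorsOn⁺ (m + j ∸ i) g (m+[n∸m]≡n (≤-trans i≤m (m≤m+n m j)))

  own-diagonal-≤ : ∀ {i j} → InGrid m n i j → m + j ∸ i ≤ m + n ∸ 1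
  own-diagonal-≤ {i} {j} ((1≤i , _) , (_ , j≤n)) =
    ≤-trans (∸-monoʳ-≤ (m + j) 1≤i) (∸-monoˡ-≤ 1 (+-monoʳ-≤ m j≤n))

  new-color-contributed : ∀ {i j} → InGrid m n i j → c i j ∉ colorsOn m n c m →
    ∃[ k ] ((1 ≤ k × k ≤ m + n ∸ 1) × ContributesColor m n c k (c i j))
  new-color-contributed {i} {j} g x∉
    with k , k≤ , x∈ , before ←
           least-witness (λ k → c i j ∈? colorsOn m n c k) (∈-colorsOn-own-diagonal g) =
    k , (n≢0⇒n>0 (λ { refl → colorsOn-zero-empty x∈ }) , ≤-trans k≤ (own-diagonal-≤ g))
      , x∈ , x∉ , λ l _ l<k → before l l<k

  -- inj₁ tags colours and inj₂ diagonals.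
  Charge : ℕ ⊎ ℕ → ℕ ⊎ ℕ → Set
  Charge (inj₁ x) (inj₁ y) = x ≡ y
  Charge (inj₁ x) (inj₂ k) = ContributesColor m n c k x
  Charge (inj₂ _) (inj₁ _) = ⊥
  Charge (inj₂ k) (inj₂ l) = k ≡ l

  module _ {ks : List ℕ} (non-contributing : All (NonContributingOffDiagonal m n c) ks) where

    never-contributes : ∀ {k x} → k ∈ m ∷ ks → ¬ ContributesColor m n c k x
    never-contributes (here refl) (x∈ , x∉ , _) = x∉ x∈
    never-contributes (there p) contributes with _ , _ , silent ← All.lookup non-contributing p =
      silent (_ , contributes)

    charge-exists : ExactColoring m n (m + n + 1) c → 1 ≤ m → 1 ≤ n → ∀ {a} →
      a ∈ range1 (m + n + 1) ⊕ (m ∷ ks) →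
      ∃[ b ] (b ∈ deduplicate _≟_ (colorsOn m n c m) ⊕ range1 (m + n ∸ 1) × Charge a b)
    charge-exists (_ , surjective) 1≤m 1≤n {inj₁ x} p
      with 1≤x , x≤r ← ∈-range1⁻ (∈-⊕-inj₁⁻ p)
      with i , j , g , refl ← surjective x 1≤x x≤r
      with x ∈? colorsOn m n c m
    ... | yes x∈ = inj₁ x , ∈-⊕-inj₁⁺ (∈-deduplicate⁺ _≟_ x∈) , refl
    ... | no x∉ with k , (1≤k , k≤s) , contributes ← new-color-contributed g x∉ =
      inj₂ k , ∈-⊕-inj₂⁺ (∈-range1⁺ 1≤k k≤s) , contributes
    charge-exists _ 1≤m 1≤n {inj₂ k} p with ∈-⊕-inj₂⁻ {xs = range1 (m + n + 1)} p
    ... | here refl = inj₂ m , ∈-⊕-inj₂⁺ (∈-range1⁺ 1≤m m≤m+n∸1) , refl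
      where
      m≤m+n∸1 : m ≤ m + n ∸ 1
      m≤m+n∸1 = subst (m ≤_) (sym (+-∸-assoc m 1≤n)) (m≤m+n m (n ∸ 1))
    ... | there q with (1≤k , k≤s) , _ ← All.lookup non-contributing q =
      inj₂ k , ∈-⊕-inj₂⁺ (∈-range1⁺ 1≤k k≤s) , refl

    charge-injective : ¬ RainbowSolution m n c → ∀ {a a′ b} →
      a ∈ range1 (m + n + 1) ⊕ (m ∷ ks) → a′ ∈ range1 (m + n + 1) ⊕ (m ∷ ks) →
      Charge a b → Charge a′ b → a ≡ a′
    charge-injective _ {inj₁ _} {inj₁ _} {inj₁ _} _ _ refl refl = refl
    charge-injective no-rainbow {inj₁ _} {inj₁ _} {inj₂ k} _ _ (x∈ , x∉ , _) (x′∈ , x′∉ , _) =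
      cong inj₁ (new-colors-on-diagonal-equal no-rainbow k x∈ x′∈ x∉ x′∉)
    charge-injective _ {inj₁ _} {inj₂ _} {inj₂ _} _ p′ contributes refl =
      ⊥-elim (never-contributes (∈-⊕-inj₂⁻ p′) contributes)
    charge-injective _ {inj₂ _} {inj₁ _} {inj₂ _} p _ refl contributes =
      ⊥-elim (never-contributes (∈-⊕-inj₂⁻ p) contributes)
    charge-injective _ {inj₂ _} {inj₂ _} {inj₂ _} _ _ refl refl = refl

    charging-count : ExactColoring m n (m + n + 1) c → ¬ RainbowSolution m n c →
      1 ≤ m → 1 ≤ n → Unique ks →
      m + n + 1 + suc (length ks) ≤ numColorsOn m n c m + (m + n ∸ 1)
    charging-count exact no-rainbow 1≤m 1≤n unique-ks =
      subst₂ _≤_ (length-⊕-range1ˡ (m + n + 1) (m ∷ ks)) (length-⊕-range1ʳ main (m + n ∸ 1))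
        (length-≤-of-injective-relation Charge
          (⊕-unique (range1-unique (m + n + 1)) (m∉ks ∷ unique-ks))
          (charge-exists exact 1≤m 1≤n)
          (charge-injective no-rainbow))
      where
      main : List ℕ
      main = deduplicate _≟_ (colorsOn m n c m)
      m∉ks : All (m ≢_) ks
      m∉ks = All.map (λ { (_ , k≢m , _) → k≢m ∘ sym }) non-contributing

charges-bound : ∀ {a b D} → 1 ≤ a → a + 1 + suc b ≤ D + (a ∸ 1) → b + 3 ≤ D
charges-bound {suc s} {b} {D} _ le = +-cancelˡ-≤ s _ _ (subst₂ _≤_ shuffle (+-comm D s) le)
  where
  open +-*-Solver
  shuffle : suc s + 1 + suc b ≡ s + (b + 3)
  shuffle = solve 2 (λ s b → con 1 :+ s :+ con 1 :+ (con 1 :+ b) := s :+ (b :+ con 3)) refl s b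

lemma2p10 : (m n : ℕ) → 3 ≤ m → m ≤ n → (c : Coloring) →
    ExactColoring m n (m + n + 1) c → ¬ RainbowSolution m n c →
    (ks : List ℕ) → Unique ks → All (NonContributingOffDiagonal m n c) ks →
    length ks + 3 ≤ numColorsOn m n c m
lemma2p10 m n 3≤m m≤n c exact no-rainbow ks unique-ks non-contributing =
  charges-bound (≤-trans 1≤m (m≤m+n m n))
    (charging-count m n c non-contributing exact no-rainbow 1≤m (≤-trans 1≤m m≤n) unique-ks)
  where
  1≤m : 1 ≤ m
  1≤m = ≤-trans (s≤s z≤n) 3≤m
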